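{- Let $q$ be a prime power and $v,k$ positive integers. A $2$-$(v,P_k,1)_q$ design with $q$ even cannot exist. A $2$-$(v,P_k,1)_q$ design with $q$ odd and $k$ even exists only if $v\equiv 0$ or $1\pmod{k-1}$. A $2$-$(v,P_k,1)_q$ design with $q$ odd and $k$ odd exists only if $v\equiv 0$ or $1\pmod{2(k-1)}$.
   Context: $[n]_q=\frac{q^n-1}{q-1}$; $\mathrm{PG}(\mathbb{F}_q^v)$ is the $(v-1)$-dimensional projective space over $\mathbb{F}_q$. $P_N$ denotes the path with $N$ vertices. A $2$-$(v,P_k,1)_q$ design means a collection of graphs isomorphic to $P_{[k]_q}$, each having as vertex set the point set of a $(k-1)$-dimensional projective subspace of $\mathrm{PG}(\mathbb{F}_q^v)$, such that any two distinct points of $\mathrm{PG}(\mathbb{F}_q^v)$ are adjacent in exactly one of these graphs. -}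

module Defs where

open import Level using (0ℓ)
open import Data.Nat as ℕ using (ℕ; zero; suc; _^_)
open import Data.Nat.Primality using (Prime)
open import Data.Fin using (Fin; zero; suc; toℕ)
open import Data.Product using (Σ; ∃; _×_; _,_)
open import Data.Sum using (_⊎_)
open import Relation.Nullary using (¬_)
open import Relation.Binary.PropositionalEquality as ≡ using (_≡_)
open import Algebra.Bundles using (CommutativeRing)
open import Function.Bundles using (Bijection)

IsPrimePower : ℕ → Set
IsPrimePower q = Σ ℕ λ p → Σ ℕ λ n → Prime p × q ≡ p ^ suc n

-- Gaussian number [n]_q = 1 + q + ... + q^(n-1)  ( = (q^n - 1)/(q - 1) for q ≥ 2 )
gauss : ℕ → ℕ → ℕ
gauss q zero = 0
gauss q (suc n) = 1 ℕ.+ q ℕ.* gauss q n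

IsFieldCR : CommutativeRing 0ℓ 0ℓ → Set
IsFieldCR R = ¬ (0# ≈ 1#) × (∀ x → ¬ (x ≈ 0#) → Σ Carrier λ y → x * y ≈ 1#)
  where open CommutativeRing R

record FiniteField (q : ℕ) : Set₁ where
  field
    ring    : CommutativeRing 0ℓ 0ℓ
    isField : IsFieldCR ring
    card    : Bijection (≡.setoid (Fin q)) (CommutativeRing.setoid ring)

module _ {q : ℕ} (F : FiniteField q) (v : ℕ) where
  open FiniteField F
  open CommutativeRing ring using (Carrier; _≈_; _+_; _*_; 0#; 1#)

  Vect : Set
  Vect = Fin v → Carrier

  _≈ᵥ_ : Vect → Vect → Set
  u ≈ᵥ w = ∀ i → u i ≈ w i

  0ᵥ : Vect
  0ᵥ _ = 0#

  NonZeroV : Vect → Set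
  NonZeroV u = ¬ (u ≈ᵥ 0ᵥ)

  SamePoint : Vect → Vect → Set
  SamePoint u w = Σ Carrier λ c → ∀ i → w i ≈ c * u i

  ΣF : {m : ℕ} → (Fin m → Carrier) → Carrier
  ΣF {zero} f = 0#
  ΣF {suc m} f = f zero + ΣF (λ j → f (suc j))

  linComb : {m : ℕ} → (Fin m → Carrier) → (Fin m → Vect) → Vect
  linComb a b i = ΣF (λ j → a j * b j i)

  LinIndep : {m : ℕ} → (Fin m → Vect) → Set
  LinIndep {m} b = (a : Fin m → Carrier) → linComb a b ≈ᵥ 0ᵥ → ∀ j → a j ≈ 0#

  InSpan : {m : ℕ} → (Fin m → Vect) → Vect → Set
  InSpan {m} b u = Σ (Fin m → Carrier) λ a → u ≈ᵥ linComb a b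

  -- A block: a path P_[k]_q whose vertex set is exactly the point set of the
  -- (k-1)-dimensional projective subspace spanned by the independent vectors
  -- basis; the path visits verts 0, verts 1, ..., in this order.
  record Block (k : ℕ) : Set where
    field
      basis    : Fin k → Vect
      indep    : LinIndep basis
      verts    : Fin (gauss q k) → Vect
      nonzero  : ∀ j → NonZeroV (verts j)
      inside   : ∀ j → InSpan basis (verts j)
      covers   : ∀ u → NonZeroV u → InSpan basis u → Σ (Fin (gauss q k)) λ j → SamePoint (verts j) u
      distinct : ∀ j j' → SamePoint (verts j) (verts j') → j ≡ j'

  Adjacent : {k : ℕ} → Block k → Vect → Vect → Set
  Adjacent {k} B x y = Σ (Fin (gauss q k)) λ j → Σ (Fin (gauss q k)) λ j' →
      toℕ j' ≡ suc (toℕ j) ×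
      ((SamePoint (verts j) x × SamePoint (verts j') y) ⊎
       (SamePoint (verts j) y × SamePoint (verts j') x))
    where open Block B

  Design : ℕ → Set
  Design k = Σ ℕ λ b → Σ (Fin b → Block k) λ B →
    ∀ x y → NonZeroV x → NonZeroV y → ¬ SamePoint x y →
      Σ (Fin b) λ i → Adjacent (B i) x y × (∀ i' → Adjacent (B i') x y → i' ≡ i)

-- Count the ordered pairs (x, y) of nonzero vectors of F_q^v spanning distinct points in two ways.
-- Directly there are (q^v - 1)(q^v - q) of them.  Each is an ordered edge of exactly one block, and each
-- of the [k]_q - 1 = q[k-1]_q edges of a block accounts for 2(q - 1)^2 pairs; hence
-- [v]_q [v-1]_q = 2 b [k-1]_q, with b the number of blocks.
-- If q is even, the left-hand side is odd.  In general, gcd([m], [n]) divides [gcd(m, n)]; if k - 1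
-- divided neither v nor v - 1, then gcd(k-1, v) and gcd(k-1, v-1) would be coprime proper divisors
-- of k - 1, the product of their Gaussian numbers too small to be divisible by [k-1].
-- If q is odd then [n]_q ≡ n (mod 2); when k - 1 is even and divides v, say, then
-- [v] = [k-1] [v/(k-1)]_(q^(k-1)) with [v-1] odd, which forces v/(k-1) to be even.

module Submission where

open import Defs
open import Data.Nat using (ℕ; zero; suc; _+_; _*_; _∸_; _^_; _≤_; _<_; z≤n; s≤s; >-nonZero; nonTrivial⇒n>1)
open import Data.Nat.Properties
open import Data.Nat.Divisibility
open import Data.Nat.GCD
open import Data.Nat.Coprimality using (Coprime)
open import Data.Nat.Primality using (euclidsLemma; prime[2]; prime⇒nonZero; prime⇒nonTrivial)
open import Data.Nat.Solver using (module +-*-Solver)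
open import Data.Fin as Fin using (Fin; zero; suc; inject₁; toℕ; finToFun; funToFin; combine)
open import Data.Fin.Properties
  using (funToFin-finToFin; finToFun-funToFin; any?; ¬∀⟶∃¬; toℕ-inject₁; inject₁-injective; toℕ-injective)
open import Data.Product using (∃; _×_; _,_; proj₁; proj₂)
open import Data.Sum using (_⊎_; inj₁; inj₂)
open import Data.Empty using (⊥; ⊥-elim)
open import Function using (_∘_)
open import Function.Bundles using (Bijection; module Surjection)
open import Relation.Binary.Bundles using (Setoid)
open import Relation.Binary.Definitions using (Decidable; tri<; tri≈; tri>)
open import Relation.Binary.PropositionalEquality as ≡
  using (_≡_; _≢_; _≗_; refl; sym; trans; cong; cong₂; subst; subst₂; module ≡-Reasoning)
open import Relation.Nullary using (Dec; yes; no; ¬_; ¬?)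
open import Relation.Nullary.Decidable using (map′; _×-dec_)
open import Algebra.Bundles using (CommutativeRing)
open import Algebra.Properties.Semiring.Sum +-*-semiring
  using (sum-syntax; ∑-comm; ∑-distrib-+; *-distribˡ-sum; *-distribʳ-sum; sum-cong-≗)
import Data.Vec.Functional.Relation.Binary.Equality.Setoid as VecSetoid

open +-*-Solver

-- Gaussian numbers

gauss-+ : ∀ q m n → gauss q (m + n) ≡ gauss q m + q ^ m * gauss q n
gauss-+ q zero    n = sym (+-identityʳ (gauss q n))
gauss-+ q (suc m) n = begin
  1 + q * gauss q (m + n)                        ≡⟨ cong (λ t → 1 + q * t) (gauss-+ q m n) ⟩
  1 + q * (gauss q m + q ^ m * gauss q n)        ≡⟨ solve 4 (λ q a b c → con 1 :+ q :* (a :+ b :* c) := (con 1 :+ q :* a) :+ (q :* b) :* c)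
                                                      refl q (gauss q m) (q ^ m) (gauss q n) ⟩
  gauss q (suc m) + q ^ suc m * gauss q n        ∎
  where open ≡-Reasoning

gauss-* : ∀ q m s → gauss q (s * m) ≡ gauss q m * gauss (q ^ m) s
gauss-* q m zero    = sym (*-zeroʳ (gauss q m))
gauss-* q m (suc s) = begin
  gauss q (m + s * m)                            ≡⟨ gauss-+ q m (s * m) ⟩
  gauss q m + q ^ m * gauss q (s * m)            ≡⟨ cong (λ t → gauss q m + q ^ m * t) (gauss-* q m s) ⟩
  gauss q m + q ^ m * (gauss q m * gauss (q ^ m) s)
    ≡⟨ solve 3 (λ g r h → g :+ r :* (g :* h) := g :* (con 1 :+ r :* h)) refl (gauss q m) (q ^ m) (gauss (q ^ m) s) ⟩
  gauss q m * gauss (q ^ m) (suc s)              ∎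
  where open ≡-Reasoning

[1+p]^n≡1+p*gauss : ∀ p n → suc p ^ n ≡ 1 + p * gauss (suc p) n
[1+p]^n≡1+p*gauss p zero    = cong suc (sym (*-zeroʳ p))
[1+p]^n≡1+p*gauss p (suc n) = begin
  suc p * suc p ^ n                     ≡⟨ cong (suc p *_) ([1+p]^n≡1+p*gauss p n) ⟩
  suc p * (1 + p * gauss (suc p) n)     ≡⟨ solve 2 (λ p g → (con 1 :+ p) :* (con 1 :+ p :* g) := con 1 :+ p :* (con 1 :+ (con 1 :+ p) :* g))
                                             refl p (gauss (suc p) n) ⟩
  1 + p * gauss (suc p) (suc n)         ∎
  where open ≡-Reasoning

∣gauss⇒∣gauss[s*m] : ∀ {d} q m s → d ∣ gauss q m → d ∣ gauss q (s * m)
∣gauss⇒∣gauss[s*m] q m s d∣ = subst (_ ∣_) (sym (gauss-* q m s)) (∣-trans d∣ (m∣m*n _))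

∣gauss[m+n]⇒∣gauss[n]⇒∣gauss[m] : ∀ {d} q m n → d ∣ gauss q (m + n) → d ∣ gauss q n → d ∣ gauss q m
∣gauss[m+n]⇒∣gauss[n]⇒∣gauss[m] q m n d∣m+n d∣n =
  ∣m+n∣m⇒∣n (subst (_ ∣_) (trans (gauss-+ q m n) (+-comm (gauss q m) _)) d∣m+n) (∣-trans d∣n (n∣m*n (q ^ m)))

-- By Bézout, gcd m n + y n = x m (or symmetrically), and [x m], [y n] are multiples of [m], [n].
∣gauss⇒∣gauss[gcd] : ∀ {d} q m n → d ∣ gauss q m → d ∣ gauss q n → d ∣ gauss q (gcd m n)
∣gauss⇒∣gauss[gcd] {d} q m n d∣m d∣n with Bézout.identity (gcd-GCD m n)
... | Bézout.+- x y eq = ∣gauss[m+n]⇒∣gauss[n]⇒∣gauss[m] q (gcd m n) (y * n)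
        (subst (λ t → d ∣ gauss q t) (sym eq) (∣gauss⇒∣gauss[s*m] q m x d∣m)) (∣gauss⇒∣gauss[s*m] q n y d∣n)
... | Bézout.-+ x y eq = ∣gauss[m+n]⇒∣gauss[n]⇒∣gauss[m] q (gcd m n) (x * m)
        (subst (λ t → d ∣ gauss q t) (sym eq) (∣gauss⇒∣gauss[s*m] q n y d∣n)) (∣gauss⇒∣gauss[s*m] q m x d∣m)

^≤gauss[1+n] : ∀ q n → q ^ n ≤ gauss q (suc n)
^≤gauss[1+n] q zero    = s≤s z≤n
^≤gauss[1+n] q (suc n) = ≤-trans (*-monoʳ-≤ q (^≤gauss[1+n] q n)) (n≤1+n _)

gauss<^ : ∀ {q} → 2 ≤ q → ∀ n → gauss q n < q ^ n
gauss<^ {suc (suc p)} (s≤s (s≤s _)) n = begin-strict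
  gauss (2 + p) n                 ≤⟨ m≤n*m (gauss (2 + p) n) (suc p) ⟩
  suc p * gauss (2 + p) n         <⟨ n<1+n _ ⟩
  1 + suc p * gauss (2 + p) n     ≡⟨ sym ([1+p]^n≡1+p*gauss (suc p) n) ⟩
  (2 + p) ^ n                     ∎
  where open ≤-Reasoning

gauss*gauss<gauss : ∀ {q a c m} → 2 ≤ q → a + c < m → gauss q a * gauss q c < gauss q m
gauss*gauss<gauss {q@(suc (suc _))} {a} {c} {suc m} 2≤q@(s≤s (s≤s _)) (s≤s a+c≤m) = begin-strict
  gauss q a * gauss q c           <⟨ *-mono-< (gauss<^ 2≤q a) (gauss<^ 2≤q c) ⟩
  q ^ a * q ^ c                   ≡⟨ sym (^-distribˡ-+-* q a c) ⟩
  q ^ (a + c)                     ≤⟨ ^-monoʳ-≤ q a+c≤m ⟩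
  q ^ m                           ≤⟨ ^≤gauss[1+n] q m ⟩
  gauss q (suc m)                 ∎
  where open ≤-Reasoning

0<gauss : ∀ q {n} → 0 < n → 0 < gauss q n
0<gauss q {suc _} _ = s≤s z≤n

1<gauss : ∀ {q m} → 2 ≤ q → 2 ≤ m → 1 < gauss q m
1<gauss {suc (suc _)} {suc (suc _)} (s≤s (s≤s _)) (s≤s (s≤s _)) = s≤s (s≤s z≤n)

∣∧<⇒2*≤ : ∀ {a m} → a ∣ m → a < m → 2 * a ≤ m
∣∧<⇒2*≤ {a} (divides zero refl)          ()
∣∧<⇒2*≤ {a} (divides (suc zero) refl)    a<m = ⊥-elim (<-irrefl (sym (+-identityʳ a)) a<m)
∣∧<⇒2*≤ {a} (divides (suc (suc t)) refl) _   = *-monoˡ-≤ a {2} {suc (suc t)} (s≤s (s≤s z≤n))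

coprime-proper-divisors : ∀ {a c m} → Coprime a c → a ∣ m → c ∣ m → a < m → c < m →
                          (a ≡ 1 × c ≡ 1) ⊎ a + c < m
coprime-proper-divisors {a} {c} {m} cop a∣m c∣m a<m c<m with <-cmp a c
... | tri< a<c _ _ = inj₂ (begin-strict
  a + c   <⟨ +-monoˡ-< c a<c ⟩
  c + c   ≡⟨ cong (c +_) (sym (+-identityʳ c)) ⟩
  2 * c   ≤⟨ ∣∧<⇒2*≤ c∣m c<m ⟩
  m       ∎)
  where open ≤-Reasoning
... | tri≈ _ refl _ = inj₁ (cop (∣-refl , ∣-refl) , cop (∣-refl , ∣-refl))
... | tri> _ _ c<a = inj₂ (begin-strict
  a + c   <⟨ +-monoʳ-< a c<a ⟩
  a + a   ≡⟨ cong (a +_) (sym (+-identityʳ a)) ⟩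
  2 * a   ≤⟨ ∣∧<⇒2*≤ a∣m a<m ⟩
  m       ∎)
  where open ≤-Reasoning

∣*⇒∣gcd*gcd : ∀ n x y → n ∣ x * y → n ∣ gcd n x * gcd n y
∣*⇒∣gcd*gcd n x y n∣xy = subst (n ∣_) (sym gcd*gcd≡) (gcd-greatest (n∣m*n gy) n∣gy*x)
  where
  gy : ℕ
  gy = gcd n y
  gcd*gcd≡ : gcd n x * gy ≡ gcd (gy * n) (gy * x)
  gcd*gcd≡ = trans (*-comm (gcd n x) gy) (c*gcd[m,n]≡gcd[cm,cn] gy n x)
  n∣gy*x : n ∣ gy * x
  n∣gy*x = subst (n ∣_) (trans (sym (c*gcd[m,n]≡gcd[cm,cn] x n y)) (*-comm x gy))
             (gcd-greatest (n∣m*n x) n∣xy)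

gcd-consecutive-coprime : ∀ m n → Coprime (gcd m (suc n)) (gcd m n)
gcd-consecutive-coprime m n {d} (d∣a , d∣c) =
  ∣1⇒≡1 (∣m+n∣m⇒∣n (subst (d ∣_) (+-comm 1 n) (∣-trans d∣a (gcd[m,n]∣n m (suc n))))
                     (∣-trans d∣c (gcd[m,n]∣n m n)))

gauss∣gauss*gauss⇒∣⊎∣ : ∀ {q m} n → 2 ≤ q → 1 ≤ m →
                        gauss q m ∣ gauss q (suc n) * gauss q n → m ∣ suc n ⊎ m ∣ n
gauss∣gauss*gauss⇒∣⊎∣ {q} {m} n 2≤q 1≤m [m]∣ with m ∣? suc n | m ∣? n
... | yes m∣1+n | _      = inj₁ m∣1+n
... | no _      | yes m∣n = inj₂ m∣n
... | no m∤1+n  | no m∤n = ⊥-elim (<⇒≱ [a]*[c]<[m] [m]≤[a]*[c])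
  where
  a c : ℕ
  a = gcd m (suc n)
  c = gcd m n
  m≢0 : m ≢ 0
  m≢0 m≡0 = <⇒≢ 1≤m (sym m≡0)
  proper : ∀ {k} → ¬ m ∣ k → gcd m k < m
  proper {k} m∤k = ≤∧≢⇒< (∣⇒≤ {{>-nonZero 1≤m}} (gcd[m,n]∣m m k))
                         (λ g≡m → m∤k (subst (_∣ k) g≡m (gcd[m,n]∣n m k)))
  0<[gcd] : ∀ k → 0 < gauss q (gcd m k)
  0<[gcd] k = 0<gauss q (n≢0⇒n>0 (gcd[m,n]≢0 m k (inj₁ m≢0)))
  [m]∣[a]*[c] : gauss q m ∣ gauss q a * gauss q c
  [m]∣[a]*[c] = ∣-trans (∣*⇒∣gcd*gcd (gauss q m) (gauss q (suc n)) (gauss q n) [m]∣)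
    (*-pres-∣ (∣gauss⇒∣gauss[gcd] q m (suc n) (gcd[m,n]∣m _ (gauss q (suc n))) (gcd[m,n]∣n (gauss q m) _))
              (∣gauss⇒∣gauss[gcd] q m n (gcd[m,n]∣m _ (gauss q n)) (gcd[m,n]∣n (gauss q m) _)))
  [m]≤[a]*[c] : gauss q m ≤ gauss q a * gauss q c
  [m]≤[a]*[c] = ∣⇒≤ {{>-nonZero (*-mono-≤ (0<[gcd] (suc n)) (0<[gcd] n))}} [m]∣[a]*[c]
  [a]*[c]<[m] : gauss q a * gauss q c < gauss q m
  [a]*[c]<[m] with coprime-proper-divisors (gcd-consecutive-coprime m n)
                     (gcd[m,n]∣m m (suc n)) (gcd[m,n]∣m m n) (proper m∤1+n) (proper m∤n)
  ... | inj₂ a+c<m = gauss*gauss<gauss {a = a} {c} 2≤q a+c<m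
  ... | inj₁ (a≡1 , c≡1) = subst₂ (λ x y → gauss q x * gauss q y < gauss q m) (sym a≡1) (sym c≡1)
                             (subst (_< gauss q m) (sym 1*1≡[1]*[1]) (1<gauss 2≤q 2≤m))
    where
    1*1≡[1]*[1] : gauss q 1 * gauss q 1 ≡ 1
    1*1≡[1]*[1] = cong (λ t → suc t * suc t) (*-zeroʳ q)
    2≤m : 2 ≤ m
    2≤m = ≤∧≢⇒< 1≤m (λ 1≡m → m∤n (subst (_∣ n) 1≡m (1∣ n)))

-- Parity of Gaussian numbers

2∤n⇒2∣1+n : ∀ {n} → ¬ 2 ∣ n → 2 ∣ suc n
2∤n⇒2∣1+n {zero}        2∤0   = ⊥-elim (2∤0 (2 ∣0))
2∤n⇒2∣1+n {suc zero}    _     = ∣-refl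
2∤n⇒2∣1+n {suc (suc n)} 2∤2+n = ∣m∣n⇒∣m+n (∣-refl {2}) (2∤n⇒2∣1+n (2∤2+n ∘ ∣m∣n⇒∣m+n ∣-refl))

2∣1+n⇒2∤n : ∀ {n} → 2 ∣ suc n → ¬ 2 ∣ n
2∣1+n⇒2∤n {n} 2∣1+n 2∣n = 2≢1 (∣1⇒≡1 (∣m+n∣m⇒∣n (subst (2 ∣_) (+-comm 1 n) 2∣1+n) 2∣n))
  where
  2≢1 : 2 ≢ 1
  2≢1 ()

2∣n⇒2∤1+n : ∀ {n} → 2 ∣ n → ¬ 2 ∣ suc n
2∣n⇒2∤1+n 2∣n 2∣1+n = 2∣1+n⇒2∤n 2∣1+n 2∣n

2∣q⇒2∤gauss[1+n] : ∀ {q} n → 2 ∣ q → ¬ 2 ∣ gauss q (suc n)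
2∣q⇒2∤gauss[1+n] {q} n 2∣q 2∣[1+n] = 2∣1+n⇒2∤n 2∣[1+n] (∣-trans 2∣q (m∣m*n (gauss q n)))

2∣1+q⇒2∣gauss+n : ∀ {q} → 2 ∣ suc q → ∀ n → 2 ∣ gauss q n + n
2∣1+q⇒2∣gauss+n 2∣1+q zero    = 2 ∣0
2∣1+q⇒2∣gauss+n {q} 2∣1+q (suc n) = ∣m+n∣m⇒∣n (subst (2 ∣_) reorder 2∣sum) (n∣m*n (gauss q n))
  where
  G : ℕ
  G = gauss q n
  2∣sum : 2 ∣ 2 + (suc q * G + (G + n))
  2∣sum = ∣m∣n⇒∣m+n ∣-refl (∣m∣n⇒∣m+n (∣-trans 2∣1+q (m∣m*n G)) (2∣1+q⇒2∣gauss+n 2∣1+q n))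
  reorder : 2 + (suc q * G + (G + n)) ≡ G * 2 + (gauss q (suc n) + suc n)
  reorder = solve 3 (λ q G n → con 2 :+ ((con 1 :+ q) :* G :+ (G :+ n)) := G :* con 2 :+ ((con 1 :+ q :* G) :+ (con 1 :+ n)))
                    refl q G n

2∤q⇒2∤q^m : ∀ {q} → ¬ 2 ∣ q → ∀ m → ¬ 2 ∣ q ^ m
2∤q⇒2∤q^m 2∤q zero    = 2∣1+n⇒2∤n ∣-refl
2∤q⇒2∤q^m {q} 2∤q (suc m) 2∣q^1+m with euclidsLemma q (q ^ m) prime[2] 2∣q^1+m
... | inj₁ 2∣q   = 2∤q 2∣q
... | inj₂ 2∣q^m = 2∤q⇒2∤q^m 2∤q m 2∣q^m

2∤q⇒2∣gauss⇒2∣ : ∀ {q n} → ¬ 2 ∣ q → 2 ∣ gauss q n → 2 ∣ n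
2∤q⇒2∣gauss⇒2∣ {q} {n} 2∤q = ∣m+n∣m⇒∣n (2∣1+q⇒2∣gauss+n (2∤n⇒2∣1+n 2∤q) n)

∣⇒2*∣ : ∀ {q m w y} b → ¬ 2 ∣ q → 1 ≤ m → m ∣ w → ¬ 2 ∣ y →
        gauss q w * gauss q y ≡ 2 * b * gauss q m → 2 * m ∣ w
∣⇒2*∣ {q} {m@(suc _)} {y = y} b 2∤q (s≤s z≤n) (divides s refl) 2∤y eq = *-monoˡ-∣ m 2∣s
  where
  H : ℕ
  H = gauss (q ^ m) s
  H*[y]≡2*b : H * gauss q y ≡ 2 * b
  H*[y]≡2*b = *-cancelˡ-≡ _ _ (gauss q m) (begin
    gauss q m * (H * gauss q y)     ≡⟨ sym (*-assoc (gauss q m) H (gauss q y)) ⟩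
    gauss q m * H * gauss q y       ≡⟨ cong (_* gauss q y) (sym (gauss-* q m s)) ⟩
    gauss q (s * m) * gauss q y     ≡⟨ eq ⟩
    2 * b * gauss q m               ≡⟨ *-comm (2 * b) (gauss q m) ⟩
    gauss q m * (2 * b)             ∎)
    where open ≡-Reasoning
  2∣H : 2 ∣ H
  2∣H with euclidsLemma H (gauss q y) prime[2] (divides b (trans H*[y]≡2*b (*-comm 2 b)))
  ... | inj₁ 2∣H   = 2∣H
  ... | inj₂ 2∣[y] = ⊥-elim (2∤y (2∤q⇒2∣gauss⇒2∣ 2∤q 2∣[y]))
  2∣s : 2 ∣ s
  2∣s = 2∤q⇒2∣gauss⇒2∣ (2∤q⇒2∤q^m 2∤q m) 2∣H

2∣q⇒2∤gauss[2+n]*gauss[1+n] : ∀ {q} n → 2 ∣ q → ¬ 2 ∣ gauss q (suc (suc n)) * gauss q (suc n)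
2∣q⇒2∤gauss[2+n]*gauss[1+n] {q} n 2∣q 2∣product
  with euclidsLemma (gauss q (suc (suc n))) (gauss q (suc n)) prime[2] 2∣product
... | inj₁ 2∣[2+n] = 2∣q⇒2∤gauss[1+n] (suc n) 2∣q 2∣[2+n]
... | inj₂ 2∣[1+n] = 2∣q⇒2∤gauss[1+n] n 2∣q 2∣[1+n]

∣⊎∣⇒2*∣⊎2*∣ : ∀ {q m} n b → ¬ 2 ∣ q → 1 ≤ m → 2 ∣ m →
              gauss q (suc n) * gauss q n ≡ 2 * b * gauss q m → m ∣ suc n ⊎ m ∣ n → 2 * m ∣ suc n ⊎ 2 * m ∣ n
∣⊎∣⇒2*∣⊎2*∣ {q} n b 2∤q 1≤m 2∣m eq (inj₁ m∣1+n) =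
  inj₁ (∣⇒2*∣ b 2∤q 1≤m m∣1+n (2∣1+n⇒2∤n (∣-trans 2∣m m∣1+n)) eq)
∣⊎∣⇒2*∣⊎2*∣ {q} n b 2∤q 1≤m 2∣m eq (inj₂ m∣n) =
  inj₂ (∣⇒2*∣ b 2∤q 1≤m m∣n (2∣n⇒2∤1+n (∣-trans 2∣m m∣n)) (trans (*-comm (gauss q n) _) eq))

gauss-identity⇒1≤m : ∀ {q a c b m} → gauss q (suc a) * gauss q (suc c) ≡ 2 * b * gauss q m → 1 ≤ m
gauss-identity⇒1≤m {b = b} {m = zero} eq with trans eq (*-zeroʳ (2 * b))
... | ()
gauss-identity⇒1≤m {m = suc _} _ = s≤s z≤n

m+n≡o⇒m≡o∸n : ∀ m n {o} → m + n ≡ o → m ≡ o ∸ n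
m+n≡o⇒m≡o∸n m n refl = sym (m+n∸n≡m m n)

double-count⇒gauss-identity : ∀ {q} → 2 ≤ q → ∀ v k b →
  (q ^ suc v ∸ 1) * (q ^ suc v ∸ q) ≡ b * (q * gauss q k * ((q ∸ 1) * (q ∸ 1) + (q ∸ 1) * (q ∸ 1))) →
  gauss q (suc v) * gauss q v ≡ 2 * b * gauss q k
double-count⇒gauss-identity {q@(suc P@(suc p))} (s≤s (s≤s z≤n)) v k b eq = *-cancelˡ-≡ _ _ (P * P * q) (begin
  P * P * q * (gauss q (suc v) * gauss q v)
    ≡⟨ solve 4 (λ P q a c → P :* P :* q :* (a :* c) := (P :* a) :* (P :* q :* c)) refl P q (gauss q (suc v)) (gauss q v) ⟩
  (P * gauss q (suc v)) * (P * q * gauss q v)   ≡⟨ cong₂ _*_ (sym (q^n∸1 (suc v))) (sym q^[1+v]∸q) ⟩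
  (q ^ suc v ∸ 1) * (q ^ suc v ∸ q)             ≡⟨ eq ⟩
  b * (q * gauss q k * (P * P + P * P))
    ≡⟨ solve 4 (λ b q g P → b :* (q :* g :* (P :* P :+ P :* P)) := P :* P :* q :* (con 2 :* b :* g)) refl b q (gauss q k) P ⟩
  P * P * q * (2 * b * gauss q k)               ∎)
  where
  open ≡-Reasoning
  q^n∸1 : ∀ n → q ^ n ∸ 1 ≡ P * gauss q n
  q^n∸1 n = cong (_∸ 1) ([1+p]^n≡1+p*gauss P n)
  q^[1+v]∸q : q ^ suc v ∸ q ≡ P * q * gauss q v
  q^[1+v]∸q = begin
    q * q ^ v ∸ q                    ≡⟨ cong (λ t → q * t ∸ q) ([1+p]^n≡1+p*gauss P v) ⟩
    q * (1 + P * gauss q v) ∸ q      ≡⟨ cong (_∸ q) (solve 3 (λ q P g → q :* (con 1 :+ P :* g) := q :+ P :* q :* g) refl q P (gauss q v)) ⟩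
    q + P * q * gauss q v ∸ q        ≡⟨ m+n∸m≡n q _ ⟩
    P * q * gauss q v                ∎

primePower⇒2≤ : ∀ {q} → IsPrimePower q → 2 ≤ q
primePower⇒2≤ (p , n , p-prime , refl) =
  ≤-trans (nonTrivial⇒n>1 p {{prime⇒nonTrivial p-prime}}) (m≤m*n p (p ^ n) {{m^n≢0 p n {{prime⇒nonZero p-prime}}}})

-- Finite sums of indicators

𝟙 : ∀ {p} {P : Set p} → Dec P → ℕ
𝟙 (yes _) = 1
𝟙 (no _)  = 0

∑-const : ∀ n c → ∑[ i < n ] c ≡ n * c
∑-const zero    c = refl
∑-const (suc n) c = cong (c +_) (∑-const n c)

∑-zero : ∀ {n} {f : Fin n → ℕ} → (∀ i → f i ≡ 0) → ∑[ i < n ] f i ≡ 0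
∑-zero {n} f≡0 = trans (sum-cong-≗ f≡0) (trans (∑-const n 0) (*-zeroʳ n))

∑-supported-at : ∀ {n} {f : Fin n → ℕ} t → (∀ i → i ≢ t → f i ≡ 0) → ∑[ i < n ] f i ≡ f t
∑-supported-at {suc n} {f} zero    off = trans (cong (f zero +_) (∑-zero (λ i → off (suc i) λ ()))) (+-identityʳ _)
∑-supported-at {suc n} {f} (suc t) off =
  trans (cong (_+ ∑[ i < n ] f (suc i)) (off zero λ ())) (∑-supported-at t (λ i i≢t → off (suc i) λ { refl → i≢t refl }))

𝟙-yes : ∀ {p} {P : Set p} (P? : Dec P) → P → 𝟙 P? ≡ 1
𝟙-yes (yes _) _ = refl
𝟙-yes (no ¬p) p = ⊥-elim (¬p p)

𝟙-no : ∀ {p} {P : Set p} (P? : Dec P) → ¬ P → 𝟙 P? ≡ 0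
𝟙-no (yes p) ¬p = ⊥-elim (¬p p)
𝟙-no (no _)  _  = refl

𝟙-¬ : ∀ {p} {P : Set p} (P? : Dec P) → 𝟙 (¬? P?) + 𝟙 P? ≡ 1
𝟙-¬ (yes _) = refl
𝟙-¬ (no _)  = refl

𝟙-partition : ∀ {p r} {P : Set p} {R : Set r} (P? : Dec P) (R? : Dec R) → (P → R) →
              𝟙 R? ≡ 𝟙 (¬? P? ×-dec R?) + 𝟙 P?
𝟙-partition (yes p) (yes _) _   = refl
𝟙-partition (yes p) (no ¬r) p⇒r = ⊥-elim (¬r (p⇒r p))
𝟙-partition (no _)  (yes _) _   = refl
𝟙-partition (no _)  (no _)  _   = refl

𝟙*𝟙≡0 : ∀ {p r} {P : Set p} {R : Set r} (P? : Dec P) (R? : Dec R) → (P → R → ⊥) → 𝟙 P? * 𝟙 R? ≡ 0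
𝟙*𝟙≡0 (yes p) (yes r) ¬pr = ⊥-elim (¬pr p r)
𝟙*𝟙≡0 (yes _) (no _)  _   = refl
𝟙*𝟙≡0 (no _)  _       _   = refl

funToFin-cong : ∀ {m n} {f g : Fin m → Fin n} → f ≗ g → funToFin f ≡ funToFin g
funToFin-cong {zero}  f≗g = refl
funToFin-cong {suc m} f≗g = cong₂ combine (f≗g zero) (funToFin-cong (f≗g ∘ suc))

module _ {a ℓ} {S : Setoid a ℓ} {n : ℕ} (enum : Bijection (≡.setoid (Fin n)) S) where
  open Setoid S using (_≈_) renaming (trans to ≈-trans; sym to ≈-sym; reflexive to ≈-reflexive)
  open Bijection enum using (to; injective; surjection)
  open Surjection surjection using (to⁻; to∘to⁻)

  infix 4 _≈?_
  _≈?_ : Decidable _≈_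
  x ≈? y = map′ (λ eq → ≈-trans (≈-sym (to∘to⁻ x)) (≈-trans (≈-reflexive (cong to eq)) (to∘to⁻ y)))
                (λ x≈y → injective (≈-trans (to∘to⁻ x) (≈-trans x≈y (≈-sym (to∘to⁻ y)))))
               (to⁻ x Fin.≟ to⁻ y)

  ∑-𝟙-≈ : ∀ y → ∑[ i < n ] 𝟙 (to i ≈? y) ≡ 1
  ∑-𝟙-≈ y = trans (∑-supported-at (to⁻ y) (λ i i≢ → 𝟙-no (to i ≈? y) (λ toi≈y → i≢ (injective (≈-trans toi≈y (≈-sym (to∘to⁻ y)))))))
                    (𝟙-yes (to (to⁻ y) ≈? y) (to∘to⁻ y))

  open VecSetoid S using (≋-setoid; ≋-refl)

  vectorBijection : ∀ v → Bijection (≡.setoid (Fin (n ^ v))) (≋-setoid v)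
  vectorBijection v = record
    { to        = λ i → to ∘ finToFun i
    ; cong      = λ { refl → ≋-refl }
    ; bijective = injective′ , surjective′
    }
    where
    injective′ : ∀ {i j} → (∀ k → to (finToFun i k) ≈ to (finToFun j k)) → i ≡ j
    injective′ {i} {j} eq = trans (sym (funToFin-finToFin {v} {n} i))
      (trans (funToFin-cong (λ k → injective (eq k))) (funToFin-finToFin {v} {n} j))
    surjective′ : ∀ x → ∃ λ i → ∀ {j} → j ≡ i → ∀ k → to (finToFun j k) ≈ x k
    surjective′ x = funToFin (to⁻ ∘ x) , λ { refl k →
      ≈-trans (≈-reflexive (cong to (finToFun-funToFin (to⁻ ∘ x) k))) (to∘to⁻ (x k)) }

-- Counting in PG(F_q^v)

module Projective {q : ℕ} (F : FiniteField q) (v : ℕ) where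
  open FiniteField F
  module R = CommutativeRing ring
  open R using (Carrier; _≈_; 0#; 1#) renaming (_*_ to _·_)
  open Bijection card using (to; injective)
  open Surjection (Bijection.surjection card) using (to⁻; to∘to⁻)

  V : Set
  V = Vect F v

  enumV : Bijection (≡.setoid (Fin (q ^ v))) (VecSetoid.≋-setoid R.setoid v)
  enumV = vectorBijection card v

  vec : Fin (q ^ v) → V
  vec = Bijection.to enumV

  infix 4 _≟ᵥ_
  _≟ᵥ_ : (x y : V) → Dec (_≈ᵥ_ F v x y)
  _≟ᵥ_ = _≈?_ enumV

  infixr 7 _·ᵥ_
  _·ᵥ_ : Carrier → V → V
  (c ·ᵥ u) i = c · u i

  NonZeroV? : ∀ x → Dec (NonZeroV F v x)
  NonZeroV? x = ¬? (x ≟ᵥ 0ᵥ F v)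

  SamePoint? : ∀ u w → Dec (SamePoint F v u w)
  SamePoint? u w = map′ (λ (a , w≈au) → to a , w≈au)
                        (λ (c , w≈cu) → to⁻ c , λ i → R.trans (w≈cu i) (R.*-congʳ (R.sym (to∘to⁻ c))))
                        (any? λ a → w ≟ᵥ to a ·ᵥ u)

  OnPoint : V → V → Set
  OnPoint P x = NonZeroV F v x × SamePoint F v P x

  OnPoint? : ∀ P x → Dec (OnPoint P x)
  OnPoint? P x = NonZeroV? x ×-dec SamePoint? P x

  nonzero-coordinate : ∀ {w} → NonZeroV F v w → ∃ λ i → ¬ (w i ≈ 0#)
  nonzero-coordinate {w} = ¬∀⟶∃¬ v _ (λ i → _≈?_ card (w i) 0#)

  ·-cancelʳ : ∀ {s t w} → ¬ (w ≈ 0#) → s · w ≈ t · w → s ≈ t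
  ·-cancelʳ {s} {t} {w} w≉0 sw≈tw with proj₂ isField w w≉0
  ... | w⁻¹ , ww⁻¹≈1 = begin
    s                 ≈⟨ R.sym (R.*-identityʳ s) ⟩
    s · 1#            ≈⟨ R.*-congˡ (R.sym ww⁻¹≈1) ⟩
    s · (w · w⁻¹)     ≈⟨ R.sym (R.*-assoc s w w⁻¹) ⟩
    (s · w) · w⁻¹     ≈⟨ R.*-congʳ sw≈tw ⟩
    (t · w) · w⁻¹     ≈⟨ R.*-assoc t w w⁻¹ ⟩
    t · (w · w⁻¹)     ≈⟨ R.*-congˡ ww⁻¹≈1 ⟩
    t · 1#            ≈⟨ R.*-identityʳ t ⟩
    t                 ∎
    where open import Relation.Binary.Reasoning.Setoid R.setoid

  count : {P : V → Set} → (∀ x → Dec (P x)) → ℕ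
  count P? = ∑[ i < q ^ v ] 𝟙 (P? (vec i))

  count-≈ᵥ : ∀ y → count (_≟ᵥ y) ≡ 1
  count-≈ᵥ = ∑-𝟙-≈ enumV

  count-complement : {P : V → Set} (P? : ∀ x → Dec (P x)) → count (¬? ∘ P?) + count P? ≡ q ^ v
  count-complement P? = begin
    count (¬? ∘ P?) + count P?                            ≡⟨ sym (∑-distrib-+ (λ i → 𝟙 (¬? (P? (vec i)))) _) ⟩
    ∑[ i < q ^ v ] (𝟙 (¬? (P? (vec i))) + 𝟙 (P? (vec i))) ≡⟨ sum-cong-≗ (λ i → 𝟙-¬ (P? (vec i))) ⟩
    ∑[ i < q ^ v ] 1                                      ≡⟨ ∑-const (q ^ v) 1 ⟩
    q ^ v * 1                                             ≡⟨ *-identityʳ (q ^ v) ⟩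
    q ^ v                                                 ∎
    where open ≡-Reasoning

  𝟙-SamePoint : ∀ {w} → NonZeroV F v w → ∀ x → 𝟙 (SamePoint? w x) ≡ ∑[ a < q ] 𝟙 (x ≟ᵥ to a ·ᵥ w)
  𝟙-SamePoint {w} w≉0 x with SamePoint? w x
  ... | no ¬sp = sym (∑-zero (λ a → 𝟙-no (x ≟ᵥ to a ·ᵥ w) (λ x≈aw → ¬sp (to a , x≈aw))))
  ... | yes (c , x≈cw) = sym (trans
          (∑-supported-at (to⁻ c) (λ a a≢c → 𝟙-no (x ≟ᵥ to a ·ᵥ w) (a≢c ∘ scalar-unique a)))
          (𝟙-yes (x ≟ᵥ to (to⁻ c) ·ᵥ w) (λ i → R.trans (x≈cw i) (R.*-congʳ (R.sym (to∘to⁻ c))))))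
    where
    scalar-unique : ∀ a → _≈ᵥ_ F v x (to a ·ᵥ w) → a ≡ to⁻ c
    scalar-unique a x≈aw with nonzero-coordinate w≉0
    ... | i , wᵢ≉0 = injective (·-cancelʳ wᵢ≉0
          (R.trans (R.sym (x≈aw i)) (R.trans (x≈cw i) (R.*-congʳ (R.sym (to∘to⁻ c))))))

  count-SamePoint : ∀ {w} → NonZeroV F v w → count (SamePoint? w) ≡ q
  count-SamePoint {w} w≉0 = begin
    ∑[ i < q ^ v ] 𝟙 (SamePoint? w (vec i))              ≡⟨ sum-cong-≗ (𝟙-SamePoint w≉0 ∘ vec) ⟩
    ∑[ i < q ^ v ] ∑[ a < q ] 𝟙 (vec i ≟ᵥ to a ·ᵥ w)      ≡⟨ ∑-comm (λ i a → 𝟙 (vec i ≟ᵥ to a ·ᵥ w)) ⟩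
    ∑[ a < q ] count (_≟ᵥ to a ·ᵥ w)                     ≡⟨ sum-cong-≗ (λ a → count-≈ᵥ (to a ·ᵥ w)) ⟩
    ∑[ a < q ] 1                                         ≡⟨ ∑-const q 1 ⟩
    q * 1                                                ≡⟨ *-identityʳ q ⟩
    q                                                    ∎
    where open ≡-Reasoning

  count-¬SamePoint : ∀ {w} → NonZeroV F v w → count (¬? ∘ SamePoint? w) + q ≡ q ^ v
  count-¬SamePoint {w} w≉0 =
    trans (cong (count (¬? ∘ SamePoint? w) +_) (sym (count-SamePoint w≉0))) (count-complement (SamePoint? w))

  count-NonZeroV : count NonZeroV? + 1 ≡ q ^ v
  count-NonZeroV = trans (cong (count NonZeroV? +_) (sym (count-≈ᵥ (0ᵥ F v)))) (count-complement (_≟ᵥ 0ᵥ F v))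

  count-OnPoint : ∀ {P} → NonZeroV F v P → count (OnPoint? P) + 1 ≡ q
  count-OnPoint {P} P≉0 = begin
    count (OnPoint? P) + 1                      ≡⟨ cong (count (OnPoint? P) +_) (sym (count-≈ᵥ (0ᵥ F v))) ⟩
    count (OnPoint? P) + count (_≟ᵥ 0ᵥ F v)     ≡⟨ sym (∑-distrib-+ (λ i → 𝟙 (OnPoint? P (vec i))) _) ⟩
    ∑[ i < q ^ v ] (𝟙 (OnPoint? P (vec i)) + 𝟙 (vec i ≟ᵥ 0ᵥ F v))
      ≡⟨ sum-cong-≗ (λ i → sym (𝟙-partition (vec i ≟ᵥ 0ᵥ F v) (SamePoint? P (vec i)) zero-SamePoint)) ⟩
    count (SamePoint? P)                        ≡⟨ count-SamePoint P≉0 ⟩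
    q                                           ∎
    where
    open ≡-Reasoning
    zero-SamePoint : ∀ {x} → _≈ᵥ_ F v x (0ᵥ F v) → SamePoint F v P x
    zero-SamePoint {x} x≈0 = 0# , λ i → R.trans (x≈0 i) (R.sym (R.zeroˡ (P i)))

  SamePoint-trans : ∀ {a b c} → SamePoint F v a b → SamePoint F v b c → SamePoint F v a c
  SamePoint-trans {a} (s , b≈sa) (t , c≈tb) = t · s , λ i →
    R.trans (c≈tb i) (R.trans (R.*-congˡ (b≈sa i)) (R.sym (R.*-assoc t s (a i))))

  SamePoint-join : ∀ {a b c} → NonZeroV F v c → SamePoint F v a c → SamePoint F v b c → SamePoint F v a b
  SamePoint-join {a} {b} {c} c≉0 (s , c≈sa) (t , c≈tb) with _≈?_ card t 0#
  ... | yes t≈0 = ⊥-elim (c≉0 λ i → R.trans (c≈tb i) (R.trans (R.*-congʳ t≈0) (R.zeroˡ (b i))))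
  ... | no t≉0 with proj₂ isField t t≉0
  ... | t⁻¹ , tt⁻¹≈1 = t⁻¹ · s , λ i → begin
    b i                 ≈⟨ R.sym (R.*-identityˡ (b i)) ⟩
    1# · b i            ≈⟨ R.*-congʳ (R.sym (R.trans (R.*-comm t⁻¹ t) tt⁻¹≈1)) ⟩
    (t⁻¹ · t) · b i     ≈⟨ R.*-assoc t⁻¹ t (b i) ⟩
    t⁻¹ · (t · b i)     ≈⟨ R.*-congˡ (R.sym (c≈tb i)) ⟩
    t⁻¹ · c i           ≈⟨ R.*-congˡ (c≈sa i) ⟩
    t⁻¹ · (s · a i)     ≈⟨ R.sym (R.*-assoc t⁻¹ s (a i)) ⟩
    (t⁻¹ · s) · a i     ∎
    where open import Relation.Binary.Reasoning.Setoid R.setoid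

  arc : V → V → V → V → ℕ
  arc P Q x y = 𝟙 (OnPoint? P x) * 𝟙 (OnPoint? Q y)

  arc≡0 : ∀ {P Q x y} → (OnPoint P x → OnPoint Q y → ⊥) → arc P Q x y ≡ 0
  arc≡0 {P} {Q} {x} {y} = 𝟙*𝟙≡0 (OnPoint? P x) (OnPoint? Q y)

  arc≡1 : ∀ {P Q x y} → OnPoint P x → OnPoint Q y → arc P Q x y ≡ 1
  arc≡1 {P} {Q} {x} {y} Px Qy = cong₂ _*_ (𝟙-yes (OnPoint? P x) Px) (𝟙-yes (OnPoint? Q y) Qy)

  pairSum : (V → V → ℕ) → ℕ
  pairSum f = ∑[ c < q ^ v ] ∑[ d < q ^ v ] f (vec c) (vec d)

  pairSum-cong : ∀ {f g : V → V → ℕ} → (∀ x y → f x y ≡ g x y) → pairSum f ≡ pairSum g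
  pairSum-cong f≡g = sum-cong-≗ λ c → sum-cong-≗ λ d → f≡g (vec c) (vec d)

  pairSum-+ : ∀ f g → pairSum (λ x y → f x y + g x y) ≡ pairSum f + pairSum g
  pairSum-+ f g = trans (sum-cong-≗ λ c → ∑-distrib-+ (f (vec c) ∘ vec) (g (vec c) ∘ vec))
                          (∑-distrib-+ (λ c → ∑[ d < q ^ v ] f (vec c) (vec d)) _)

  pairSum-∑ : ∀ m (f : Fin m → V → V → ℕ) → pairSum (λ x y → ∑[ j < m ] f j x y) ≡ ∑[ j < m ] pairSum (f j)
  pairSum-∑ m f = trans (sum-cong-≗ λ c → ∑-comm λ d j → f j (vec c) (vec d))
                          (∑-comm λ c j → ∑[ d < q ^ v ] f j (vec c) (vec d))

  pairSum-arc : ∀ {P Q} → NonZeroV F v P → NonZeroV F v Q → pairSum (arc P Q) ≡ (q ∸ 1) * (q ∸ 1)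
  pairSum-arc {P} {Q} P≉0 Q≉0 = begin
    ∑[ c < q ^ v ] ∑[ d < q ^ v ] (𝟙 (OnPoint? P (vec c)) * 𝟙 (OnPoint? Q (vec d)))
      ≡⟨ sum-cong-≗ (λ c → sym (*-distribˡ-sum (𝟙 (OnPoint? P (vec c))) (λ d → 𝟙 (OnPoint? Q (vec d))))) ⟩
    ∑[ c < q ^ v ] (𝟙 (OnPoint? P (vec c)) * count (OnPoint? Q))
      ≡⟨ sym (*-distribʳ-sum (count (OnPoint? Q)) (λ c → 𝟙 (OnPoint? P (vec c)))) ⟩
    count (OnPoint? P) * count (OnPoint? Q)
      ≡⟨ cong₂ _*_ (m+n≡o⇒m≡o∸n _ 1 (count-OnPoint P≉0)) (m+n≡o⇒m≡o∸n _ 1 (count-OnPoint Q≉0)) ⟩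
    (q ∸ 1) * (q ∸ 1) ∎
    where open ≡-Reasoning

  pairSum-nonCollinear : pairSum (λ x y → 𝟙 (NonZeroV? x) * 𝟙 (¬? (SamePoint? x y))) ≡ (q ^ v ∸ 1) * (q ^ v ∸ q)
  pairSum-nonCollinear = begin
    ∑[ c < q ^ v ] ∑[ d < q ^ v ] (𝟙 (NonZeroV? (vec c)) * 𝟙 (¬? (SamePoint? (vec c) (vec d))))
      ≡⟨ sum-cong-≗ (λ c → sym (*-distribˡ-sum (𝟙 (NonZeroV? (vec c))) (λ d → 𝟙 (¬? (SamePoint? (vec c) (vec d)))))) ⟩
    ∑[ c < q ^ v ] (𝟙 (NonZeroV? (vec c)) * count (¬? ∘ SamePoint? (vec c)))
      ≡⟨ sum-cong-≗ (λ c → non-collinear-with (vec c)) ⟩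
    ∑[ c < q ^ v ] (𝟙 (NonZeroV? (vec c)) * (q ^ v ∸ q))
      ≡⟨ sym (*-distribʳ-sum (q ^ v ∸ q) (λ c → 𝟙 (NonZeroV? (vec c)))) ⟩
    count NonZeroV? * (q ^ v ∸ q)
      ≡⟨ cong (_* (q ^ v ∸ q)) (m+n≡o⇒m≡o∸n _ 1 count-NonZeroV) ⟩
    (q ^ v ∸ 1) * (q ^ v ∸ q) ∎
    where
    open ≡-Reasoning
    non-collinear-with : ∀ x → 𝟙 (NonZeroV? x) * count (¬? ∘ SamePoint? x) ≡ 𝟙 (NonZeroV? x) * (q ^ v ∸ q)
    non-collinear-with x with NonZeroV? x
    ... | yes x≉0 = cong (1 *_) (m+n≡o⇒m≡o∸n _ q (count-¬SamePoint x≉0))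
    ... | no _    = refl

  -- The [k+1] = 1 + q [k] vertices of the path give q [k] edges (inject₁ j, suc j), each counted
  -- in both orientations.
  module Path {k : ℕ} (B : Block F v (suc k)) where
    open Block B

    edge : Fin (q * gauss q k) → V → V → ℕ
    edge j x y = arc (verts (inject₁ j)) (verts (suc j)) x y + arc (verts (suc j)) (verts (inject₁ j)) x y

    edgeCount : V → V → ℕ
    edgeCount x y = ∑[ j < q * gauss q k ] edge j x y

    toℕ-consecutive : ∀ (j : Fin (q * gauss q k)) → toℕ (suc j) ≡ suc (toℕ (inject₁ j))
    toℕ-consecutive j = cong suc (sym (toℕ-inject₁ j))

    vertex-unique : ∀ {x j j'} → NonZeroV F v x → SamePoint F v (verts j) x → SamePoint F v (verts j') x → j ≡ j'
    vertex-unique x≉0 s s' = distinct _ _ (SamePoint-join x≉0 s s')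

    edgeCount-sym : ∀ x y → edgeCount x y ≡ edgeCount y x
    edgeCount-sym x y = sum-cong-≗ λ j → trans (+-comm (arc (verts (inject₁ j)) (verts (suc j)) x y) _)
      (cong₂ _+_ (arc-swap (verts (suc j)) (verts (inject₁ j))) (arc-swap (verts (inject₁ j)) (verts (suc j))))
      where
      arc-swap : ∀ P Q → arc P Q x y ≡ arc Q P y x
      arc-swap P Q = *-comm (𝟙 (OnPoint? P x)) (𝟙 (OnPoint? Q y))

    edgeCount-vanishes : ∀ {x y} → (NonZeroV F v x → NonZeroV F v y → ¬ Adjacent F v B x y) → edgeCount x y ≡ 0
    edgeCount-vanishes ¬adj = ∑-zero λ j → cong₂ _+_
      (arc≡0 λ (x≉0 , sx) (y≉0 , sy) → ¬adj x≉0 y≉0 (inject₁ j , suc j , toℕ-consecutive j , inj₁ (sx , sy)))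
      (arc≡0 λ (x≉0 , sx) (y≉0 , sy) → ¬adj x≉0 y≉0 (inject₁ j , suc j , toℕ-consecutive j , inj₂ (sy , sx)))

    edgeCount-arc : ∀ {x y} j → NonZeroV F v x → NonZeroV F v y →
                    SamePoint F v (verts (inject₁ j)) x → SamePoint F v (verts (suc j)) y → edgeCount x y ≡ 1
    edgeCount-arc {x} {y} j x≉0 y≉0 sx sy =
      trans (∑-supported-at j (λ i i≢j → cong₂ _+_ (arc≡0 (forward i≢j)) (arc≡0 (backward i))))
              (cong₂ _+_ (arc≡1 (x≉0 , sx) (y≉0 , sy)) (arc≡0 (backward j)))
      where
      forward : ∀ {i} → i ≢ j → OnPoint (verts (inject₁ i)) x → OnPoint (verts (suc i)) y → ⊥
      forward i≢j (_ , sx′) _ = i≢j (inject₁-injective (vertex-unique x≉0 sx′ sx))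
      backward : ∀ i → OnPoint (verts (suc i)) x → OnPoint (verts (inject₁ i)) y → ⊥
      backward i (_ , sx′) (_ , sy′) = m≢1+m+n (toℕ j) (begin
        toℕ j                      ≡⟨ sym (toℕ-inject₁ j) ⟩
        toℕ (inject₁ j)            ≡⟨ cong toℕ (vertex-unique x≉0 sx sx′) ⟩
        suc (toℕ i)                ≡⟨ cong suc (sym (toℕ-inject₁ i)) ⟩
        suc (toℕ (inject₁ i))      ≡⟨ cong (suc ∘ toℕ) (vertex-unique y≉0 sy′ sy) ⟩
        suc (suc (toℕ j))          ≡⟨ cong suc (+-comm 1 (toℕ j)) ⟩
        suc (toℕ j + 1)            ∎)
        where open ≡-Reasoning

    j≡inject₁j₀ : ∀ {j} {j₀ : Fin (q * gauss q k)} → toℕ (suc j₀) ≡ suc (toℕ j) → j ≡ inject₁ j₀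
    j≡inject₁j₀ {j} {j₀} e = toℕ-injective (trans (sym (suc-injective e)) (sym (toℕ-inject₁ j₀)))

    edgeCount-adjacent : ∀ {x y} → NonZeroV F v x → NonZeroV F v y → Adjacent F v B x y → edgeCount x y ≡ 1
    edgeCount-adjacent x≉0 y≉0 (j , suc j₀ , 1+j₀≡1+j , inj₁ (sx , sy)) =
      edgeCount-arc j₀ x≉0 y≉0 (subst (λ i → SamePoint F v (verts i) _) (j≡inject₁j₀ 1+j₀≡1+j) sx) sy
    edgeCount-adjacent x≉0 y≉0 (j , suc j₀ , 1+j₀≡1+j , inj₂ (sy , sx)) = trans (edgeCount-sym _ _)
      (edgeCount-arc j₀ y≉0 x≉0 (subst (λ i → SamePoint F v (verts i) _) (j≡inject₁j₀ 1+j₀≡1+j) sy) sx)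

    SamePoint⇒¬Adjacent : ∀ {x y} → NonZeroV F v y → SamePoint F v x y → ¬ Adjacent F v B x y
    SamePoint⇒¬Adjacent y≉0 sxy (j , j' , e , inj₁ (sx , sy)) =
      1+n≢n (trans (sym e) (cong toℕ (sym (vertex-unique y≉0 (SamePoint-trans sx sxy) sy))))
    SamePoint⇒¬Adjacent y≉0 sxy (j , j' , e , inj₂ (sy , sx)) =
      1+n≢n (trans (sym e) (cong toℕ (vertex-unique y≉0 (SamePoint-trans sx sxy) sy)))

    pairSum-edgeCount : pairSum edgeCount ≡ q * gauss q k * ((q ∸ 1) * (q ∸ 1) + (q ∸ 1) * (q ∸ 1))
    pairSum-edgeCount = begin
      pairSum edgeCount                                               ≡⟨ pairSum-∑ (q * gauss q k) edge ⟩
      ∑[ j < q * gauss q k ] pairSum (edge j)                         ≡⟨ sum-cong-≗ pairSum-edge ⟩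
      ∑[ j < q * gauss q k ] ((q ∸ 1) * (q ∸ 1) + (q ∸ 1) * (q ∸ 1)) ≡⟨ ∑-const (q * gauss q k) _ ⟩
      q * gauss q k * ((q ∸ 1) * (q ∸ 1) + (q ∸ 1) * (q ∸ 1))         ∎
      where
      open ≡-Reasoning
      pairSum-edge : ∀ j → pairSum (edge j) ≡ (q ∸ 1) * (q ∸ 1) + (q ∸ 1) * (q ∸ 1)
      pairSum-edge j = trans (pairSum-+ (arc (verts (inject₁ j)) (verts (suc j))) (arc (verts (suc j)) (verts (inject₁ j))))
        (cong₂ _+_ (pairSum-arc (nonzero (inject₁ j)) (nonzero (suc j))) (pairSum-arc (nonzero (suc j)) (nonzero (inject₁ j))))

  module _ {k : ℕ} (D : Design F v (suc k)) where
    open Path using (edgeCount)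

    blocks : Fin (proj₁ D) → Block F v (suc k)
    blocks = proj₁ (proj₂ D)

    𝟙-nonCollinear : ∀ x y → 𝟙 (NonZeroV? x) * 𝟙 (¬? (SamePoint? x y)) ≡ ∑[ i < proj₁ D ] edgeCount (blocks i) x y
    -- The decisions are arguments rather than `with`-abstracted: `with` would also rewrite them
    -- inside the unfolded edgeCount on the right.
    𝟙-nonCollinear x y = by-cases (NonZeroV? x) (SamePoint? x y) (y ≟ᵥ 0ᵥ F v)
      where
      RHS : ℕ
      RHS = ∑[ i < proj₁ D ] edgeCount (blocks i) x y
      by-cases : (x≉0? : Dec (NonZeroV F v x)) (sxy? : Dec (SamePoint F v x y)) → Dec (_≈ᵥ_ F v y (0ᵥ F v)) →
                 𝟙 x≉0? * 𝟙 (¬? sxy?) ≡ RHS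
      by-cases (no ¬x≉0) _ _ = sym (∑-zero λ i → Path.edgeCount-vanishes (blocks i) λ x≉0 → ⊥-elim (¬x≉0 x≉0))
      by-cases (yes _) (yes sxy) _ = sym (∑-zero λ i →
        Path.edgeCount-vanishes (blocks i) λ _ y≉0 → Path.SamePoint⇒¬Adjacent (blocks i) y≉0 sxy)
      by-cases (yes x≉0) (no ¬sxy) (yes y≈0) = ⊥-elim (¬sxy (0# , λ i → R.trans (y≈0 i) (R.sym (R.zeroˡ (x i)))))
      by-cases (yes x≉0) (no ¬sxy) (no y≉0) with proj₂ (proj₂ D) x y x≉0 y≉0 ¬sxy
      ... | i₀ , adj , unique = sym (trans
              (∑-supported-at i₀ λ i i≢i₀ → Path.edgeCount-vanishes (blocks i) λ _ _ adjᵢ → i≢i₀ (unique i adjᵢ))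
              (Path.edgeCount-adjacent (blocks i₀) x≉0 y≉0 adj))

    design-double-count : (q ^ v ∸ 1) * (q ^ v ∸ q) ≡
                          proj₁ D * (q * gauss q k * ((q ∸ 1) * (q ∸ 1) + (q ∸ 1) * (q ∸ 1)))
    design-double-count = begin
      (q ^ v ∸ 1) * (q ^ v ∸ q)                                   ≡⟨ sym pairSum-nonCollinear ⟩
      pairSum (λ x y → 𝟙 (NonZeroV? x) * 𝟙 (¬? (SamePoint? x y))) ≡⟨ pairSum-cong 𝟙-nonCollinear ⟩
      pairSum (λ x y → ∑[ i < proj₁ D ] edgeCount (blocks i) x y) ≡⟨ pairSum-∑ (proj₁ D) (edgeCount ∘ blocks) ⟩
      ∑[ i < proj₁ D ] pairSum (edgeCount (blocks i))             ≡⟨ sum-cong-≗ (Path.pairSum-edgeCount ∘ blocks) ⟩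
      ∑[ i < proj₁ D ] E                                          ≡⟨ ∑-const (proj₁ D) E ⟩
      proj₁ D * E                                                 ∎
      where
      open ≡-Reasoning
      E : ℕ
      E = q * gauss q k * ((q ∸ 1) * (q ∸ 1) + (q ∸ 1) * (q ∸ 1))

proposition8p1 : (q v k : ℕ) → IsPrimePower q → 1 ≤ k → 2 ≤ v →
    (F : FiniteField q) → Design F v k →
      ((2 ∣ q) → ⊥) ×
      ((¬ (2 ∣ q) → 2 ∣ k → ((k ∸ 1) ∣ v ⊎ (k ∸ 1) ∣ (v ∸ 1))) ×
       (¬ (2 ∣ q) → ¬ (2 ∣ k) → ((2 * (k ∸ 1)) ∣ v ⊎ (2 * (k ∸ 1)) ∣ (v ∸ 1))))
proposition8p1 q (suc (suc w)) (suc k) q-pp (s≤s z≤n) (s≤s (s≤s z≤n)) F D =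
    (λ 2∣q → 2∣q⇒2∤gauss[2+n]*gauss[1+n] w 2∣q (divides (b * gauss q k) 2∣identity))
  , (λ _ _ → k∣v⊎k∣v-1)
  , λ 2∤q 2∤1+k → ∣⊎∣⇒2*∣⊎2*∣ (suc w) b 2∤q 1≤k (∣m+n∣m⇒∣n (2∤n⇒2∣1+n 2∤1+k) ∣-refl) identity k∣v⊎k∣v-1
  where
  b : ℕ
  b = proj₁ D
  2≤q : 2 ≤ q
  2≤q = primePower⇒2≤ q-pp
  identity : gauss q (suc (suc w)) * gauss q (suc w) ≡ 2 * b * gauss q k
  identity = double-count⇒gauss-identity 2≤q (suc w) k b (Projective.design-double-count F (suc (suc w)) D)
  2∣identity : gauss q (suc (suc w)) * gauss q (suc w) ≡ b * gauss q k * 2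
  2∣identity = trans identity (trans (*-assoc 2 b (gauss q k)) (*-comm 2 (b * gauss q k)))
  1≤k : 1 ≤ k
  1≤k = gauss-identity⇒1≤m {q} {suc w} {w} {b} identity
  k∣v⊎k∣v-1 : k ∣ suc (suc w) ⊎ k ∣ suc w
  k∣v⊎k∣v-1 = gauss∣gauss*gauss⇒∣⊎∣ (suc w) 2≤q 1≤k (divides (2 * b) identity)
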